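{- Let $p$ be a permutation and let $w$ be its 3-stack word (a word over $\{A,B,C,D\}$). Then: (1) $w$ has no factor $DA$; (2) $w$ has no factor $DB$; (3) $w$ has no factor $CA$. Here a factor $XY$ means a letter $X$ immediately followed by a letter $Y$ in $w$.
   Context: Serial 3-stack algorithm: there are three stacks $S_1,S_2,S_3$ placed in series, each required to be increasing from top to bottom; $a_i$ denotes the entry on top of $S_i$. The entries of the input permutation $p=p_1\cdots p_n$ are read left to right. At each step: if the next input entry $x$ is smaller than $a_1$ (or $S_1$ is empty), $x$ is put on top of $S_1$ (move $A$). Otherwise, one finds the smallest $i\in\{1,2\}$ such that $a_i$ can move to the next stack (i.e. $S_{i+1}$ is empty or $a_i<a_{i+1}$) and moves $a_i$ onto $S_{i+1}$ (move $B$ if $i=1$, move $C$ if $i=2$). If no such $i$ exists, or if $S_1$, $S_2$ and the input have all been emptied, the entry on top of $S_3$ is moved to the output (move $D$). The 3-stack word of $p$ is the sequence of moves performed, a word of length $4n$ over $\{A,B,C,D\}$ containing $n$ copies of each letter. -}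

module Defs where

open import Data.Nat using (ℕ; zero; suc; _*_; _<?_)
open import Data.Bool using (Bool; true; false; if_then_else_)
open import Data.List using (List; []; _∷_; _++_; length)
open import Data.Product using (∃-syntax; _×_; _,_)
open import Data.Maybe using (Maybe; just; nothing)
open import Relation.Nullary using (yes; no)
open import Relation.Binary.PropositionalEquality using (_≡_)

data Move : Set where
  A B C D : Move

-- A configuration: remaining input (read left to right) and the three
-- stacks S₁, S₂, S₃, each a list whose head is the top entry aᵢ.
record Config : Set where
  constructor config
  field
    input : List ℕ
    s1 s2 s3 : List ℕ

fits : ℕ → List ℕ → Bool
fits x [] = true
fits x (y ∷ _) with x <? y
... | yes _ = true
... | no  _ = false

moveD : Config → Maybe (Move × Config)
moveD (config i s1 s2 (a3 ∷ s3)) = just (D , config i s1 s2 s3)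
moveD (config i s1 s2 []) = nothing

moveC : Config → Maybe (Move × Config)
moveC (config i s1 (a2 ∷ s2) s3) =
  if fits a2 s3 then just (C , config i s1 s2 (a2 ∷ s3))
  else moveD (config i s1 (a2 ∷ s2) s3)
moveC (config i s1 [] s3) = moveD (config i s1 [] s3)

moveB : Config → Maybe (Move × Config)
moveB (config i (a1 ∷ s1) s2 s3) =
  if fits a1 s2 then just (B , config i s1 (a1 ∷ s2) s3)
  else moveC (config i (a1 ∷ s1) s2 s3)
moveB (config i [] s2 s3) = moveC (config i [] s2 s3)

step : Config → Maybe (Move × Config)
step (config (x ∷ i) s1 s2 s3) =
  if fits x s1 then just (A , config i (x ∷ s1) s2 s3)
  else moveB (config (x ∷ i) s1 s2 s3)
step (config [] s1 s2 s3) = moveB (config [] s1 s2 s3)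

run : ℕ → Config → List Move
run zero c = []
run (suc k) c with step c
... | nothing = []
... | just (m , c') = m ∷ run k c'

-- The 3-stack word of p.  Each move advances one entry by one position
-- (input → S₁ → S₂ → S₃ → output), so the algorithm performs exactly
-- 4·length p moves; the fuel 4·length p is therefore sufficient.
threeStackWord : List ℕ → List Move
threeStackWord p = run (4 * length p) (config p [] [] [])

HasFactor : Move → Move → List Move → Set
HasFactor X Y w = ∃[ u ] ∃[ v ] (w ≡ u ++ X ∷ Y ∷ v)

-- Moves C and D leave the input and S₁ untouched, and D also leaves S₂
-- untouched.  The algorithm only performs C after A and B were found
-- impossible, and D after A, B and C were: so right after a C move A is
-- still impossible, and right after a D move both A and B still are.
-- This holds for every input list, so the permutation hypothesis is unused.
module Submission where

open import Defs
open import Data.Nat using (ℕ; suc; zero; _*_)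
open import Data.List using (List; []; _∷_; _++_; map; upTo; length)
open import Data.List.Properties using (∷-injectiveʳ)
open import Data.Bool using (true; false)
open import Data.Unit using (⊤; tt)
open import Data.Product using (_×_; _,_; proj₁; ∃-syntax)
open import Data.Sum using (_⊎_; inj₁; inj₂)
open import Data.Maybe using (just; nothing)
open import Relation.Nullary using (¬_)
open import Relation.Binary.PropositionalEquality using (_≡_; refl; sym; subst₂)
open import Data.List.Relation.Binary.Permutation.Propositional using (_↭_)

open Config

TopBlocked : List ℕ → List ℕ → Set
TopBlocked []      _ = ⊤
TopBlocked (x ∷ _) s = fits x s ≡ false

ABlocked : Config → Set
ABlocked c = TopBlocked (input c) (s1 c)

BBlocked : Config → Set
BBlocked c = TopBlocked (s1 c) (s2 c)

SameInputS₁ : Config → Config → Set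
SameInputS₁ c c′ = input c′ ≡ input c × s1 c′ ≡ s1 c

SameInputS₁S₂ : Config → Config → Set
SameInputS₁S₂ c c′ = SameInputS₁ c c′ × s2 c′ ≡ s2 c

ABlocked-respects : ∀ {c c′} → SameInputS₁ c c′ → ABlocked c → ABlocked c′
ABlocked-respects (i≡ , s₁≡) = subst₂ TopBlocked (sym i≡) (sym s₁≡)

BBlocked-respects : ∀ {c c′} → SameInputS₁S₂ c c′ → BBlocked c → BBlocked c′
BBlocked-respects ((_ , s₁≡) , s₂≡) = subst₂ TopBlocked (sym s₁≡) (sym s₂≡)

step-ABlocked : ∀ c → ABlocked c → step c ≡ moveB c
step-ABlocked (config []      _ _ _) _ = refl
step-ABlocked (config (x ∷ _) s₁ _ _) b rewrite b = refl

moveB-BBlocked : ∀ c → BBlocked c → moveB c ≡ moveC c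
moveB-BBlocked (config _ []      _ _) _ = refl
moveB-BBlocked (config _ (a ∷ _) s₂ _) b rewrite b = refl

step-A-or-moveB : ∀ c {m c′} → step c ≡ just (m , c′) →
  m ≡ A ⊎ (ABlocked c × moveB c ≡ just (m , c′))
step-A-or-moveB (config []      _  _ _) e = inj₂ (tt , e)
step-A-or-moveB (config (x ∷ _) s₁ _ _) e with fits x s₁ | e
... | true  | refl = inj₁ refl
... | false | e′   = inj₂ (refl , e′)

moveB-B-or-moveC : ∀ c {m c′} → moveB c ≡ just (m , c′) →
  m ≡ B ⊎ (BBlocked c × moveC c ≡ just (m , c′))
moveB-B-or-moveC (config _ []      _  _) e = inj₂ (tt , e)
moveB-B-or-moveC (config _ (a ∷ _) s₂ _) e with fits a s₂ | e
... | true  | refl = inj₁ refl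
... | false | e′   = inj₂ (refl , e′)

moveD-spec : ∀ c {m c′} → moveD c ≡ just (m , c′) → m ≡ D × SameInputS₁S₂ c c′
moveD-spec (config _ _ _ (_ ∷ _)) refl = refl , (refl , refl) , refl

moveC-C-or-moveD : ∀ c {m c′} → moveC c ≡ just (m , c′) →
  (m ≡ C × SameInputS₁ c c′) ⊎ moveD c ≡ just (m , c′)
moveC-C-or-moveD (config _ _ []      _)  e = inj₂ e
moveC-C-or-moveD (config _ _ (a ∷ _) s₃) e with fits a s₃ | e
... | true  | refl = inj₁ (refl , refl , refl)
... | false | e′   = inj₂ e′

moveC-sameInputS₁ : ∀ c {m c′} → moveC c ≡ just (m , c′) → SameInputS₁ c c′
moveC-sameInputS₁ c e with moveC-C-or-moveD c e
... | inj₁ (_ , same) = same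
... | inj₂ e′ with moveD-spec c e′
... | _ , same , _ = same

moveC-≢A : ∀ c {c′} → ¬ moveC c ≡ just (A , c′)
moveC-≢A c e with moveC-C-or-moveD c e
... | inj₁ (() , _)
... | inj₂ e′ with moveD-spec c e′
... | () , _

moveC-≢B : ∀ c {c′} → ¬ moveC c ≡ just (B , c′)
moveC-≢B c e with moveC-C-or-moveD c e
... | inj₁ (() , _)
... | inj₂ e′ with moveD-spec c e′
... | () , _

moveB-≢A : ∀ c {c′} → ¬ moveB c ≡ just (A , c′)
moveB-≢A c e with moveB-B-or-moveC c e
... | inj₁ ()
... | inj₂ (_ , e′) = moveC-≢A c e′

moveC-D⇒moveD : ∀ c {c′} → moveC c ≡ just (D , c′) → moveD c ≡ just (D , c′)
moveC-D⇒moveD c e with moveC-C-or-moveD c e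
... | inj₁ (() , _)
... | inj₂ e′ = e′

step-CD⇒moveC : ∀ c {m c′} → m ≡ C ⊎ m ≡ D → step c ≡ just (m , c′) →
  ABlocked c × BBlocked c × moveC c ≡ just (m , c′)
step-CD⇒moveC c m∈CD e with step-A-or-moveB c e | m∈CD
... | inj₁ refl | inj₁ ()
... | inj₁ refl | inj₂ ()
... | inj₂ (bA , e′) | _ with moveB-B-or-moveC c e′ | m∈CD
... | inj₁ refl | inj₁ ()
... | inj₁ refl | inj₂ ()
... | inj₂ (bB , e″) | _ = bA , bB , e″

step-C⇒ABlocked : ∀ c {c′} → step c ≡ just (C , c′) → ABlocked c′
step-C⇒ABlocked c {c′} e with step-CD⇒moveC c (inj₁ refl) e
... | bA , _ , e′ = ABlocked-respects {c} {c′} (moveC-sameInputS₁ c e′) bA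

step-D⇒ABBlocked : ∀ c {c′} → step c ≡ just (D , c′) → ABlocked c′ × BBlocked c′
step-D⇒ABBlocked c {c′} e with step-CD⇒moveC c (inj₂ refl) e
... | bA , bB , e′ with moveD-spec c (moveC-D⇒moveD c e′)
... | _ , same = ABlocked-respects {c} {c′} (proj₁ same) bA , BBlocked-respects {c} {c′} same bB

ABlocked⇒step-≢A : ∀ c {c′} → ABlocked c → ¬ step c ≡ just (A , c′)
ABlocked⇒step-≢A c bA e rewrite step-ABlocked c bA = moveB-≢A c e

ABBlocked⇒step-≢B : ∀ c {c′} → ABlocked c → BBlocked c → ¬ step c ≡ just (B , c′)
ABBlocked⇒step-≢B c bA bB e rewrite step-ABlocked c bA | moveB-BBlocked c bB = moveC-≢B c e

Consecutive : Move → Move → Set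
Consecutive X Y = ∃[ c ] ∃[ c′ ] ∃[ c″ ] (step c ≡ just (X , c′) × step c′ ≡ just (Y , c″))

¬Consecutive-D-A : ¬ Consecutive D A
¬Consecutive-D-A (c , c′ , _ , e , e′) = ABlocked⇒step-≢A c′ (proj₁ (step-D⇒ABBlocked c e)) e′

¬Consecutive-D-B : ¬ Consecutive D B
¬Consecutive-D-B (c , c′ , _ , e , e′) with step-D⇒ABBlocked c e
... | bA , bB = ABBlocked⇒step-≢B c′ bA bB e′

¬Consecutive-C-A : ¬ Consecutive C A
¬Consecutive-C-A (c , c′ , _ , e , e′) = ABlocked⇒step-≢A c′ (step-C⇒ABlocked c e) e′

run-factor⇒Consecutive : ∀ k c u {X Y v} → run k c ≡ u ++ X ∷ Y ∷ v → Consecutive X Y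
run-factor⇒Consecutive zero    c []      ()
run-factor⇒Consecutive zero    c (_ ∷ _) ()
run-factor⇒Consecutive (suc k) c u e with step c in e₁
run-factor⇒Consecutive (suc k) c []      () | nothing
run-factor⇒Consecutive (suc k) c (_ ∷ _) () | nothing
run-factor⇒Consecutive (suc k) c (_ ∷ u) e  | just (_ , c′) = run-factor⇒Consecutive k c′ u (∷-injectiveʳ e)
run-factor⇒Consecutive (suc zero) c [] () | just _
run-factor⇒Consecutive (suc (suc k)) c [] e | just (_ , c′) with step c′ in e₂ | e
... | nothing        | ()
... | just (_ , c″) | refl = c , c′ , c″ , e₁ , e₂

mainTheorem3 : (n : ℕ) (p : List ℕ) → p ↭ map suc (upTo n) →
    ¬ HasFactor D A (threeStackWord p)
    × ¬ HasFactor D B (threeStackWord p)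
    × ¬ HasFactor C A (threeStackWord p)
mainTheorem3 _ p _ =
    (λ (u , _ , e) → ¬Consecutive-D-A (run-factor⇒Consecutive fuel start u e))
  , (λ (u , _ , e) → ¬Consecutive-D-B (run-factor⇒Consecutive fuel start u e))
  , (λ (u , _ , e) → ¬Consecutive-C-A (run-factor⇒Consecutive fuel start u e))
  where
  fuel : ℕ
  fuel = 4 * length p
  start : Config
  start = config p [] [] []
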